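{- Let $L$ be a lower real, i.e. an element of $\mathcal L=\mathrm{Idl}(\mathbb Q,<)$, and let $U=\{q\in\mathbb Q\mid\exists s\in\mathbb Q\setminus L,\ s<q\}$. Then $L$ is a sharp element of $\mathcal L$ if and only if the pair $(L,U)$ is located, i.e. for all rationals $p<q$ we have $p\in L$ or $q\in U$.
   Context: We work constructively: informal set theory without excluded middle or choice. $\mathcal L=\mathrm{Idl}(\mathbb Q,<)$ is the set of subsets $L\subseteq\mathbb Q$ that are lower sets ($q<p\in L$ implies $q\in L$) and directed (inhabited, and for $p,q\in L$ there is $r\in L$ with $p<r$ and $q<r$), ordered by inclusion; directed suprema are unions, and it is a continuous dcpo. In a dcpo, $x\ll y$ if for every directed $S$ with $y\sqsubseteq\bigsqcup S$ some $s\in S$ has $x\sqsubseteq s$. An element $x$ is sharp if for all $u,v$ with $u\ll v$, $u\ll x$ or $\neg(v\sqsubseteq x)$. -}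

module Defs where

open import Level using (Level; _⊔_) renaming (suc to lsuc; zero to lzero)
open import Data.Rational using (ℚ; _<_)
open import Data.Product using (Σ; ∃; ∃-syntax; _×_; _,_)
open import Data.Sum using (_⊎_)
open import Relation.Nullary using (¬_)

Subset : Set₁
Subset = ℚ → Set

_⊆_ : Subset → Subset → Set
A ⊆ B = ∀ q → A q → B q

record LowerReal : Set₁ where
  field
    L         : Subset
    lower     : ∀ {p q} → q < p → L p → L q
    inhabited : ∃[ p ] L p
    directed  : ∀ {p q} → L p → L q → ∃[ r ] (L r × p < r × q < r)
open LowerReal public

_⊑_ : LowerReal → LowerReal → Set
x ⊑ y = L x ⊆ L y

-- Directed families of lower reals (a directed subset S of 𝓛 is the family
-- indexed by S itself).
IsDirected : {I : Set} → (I → LowerReal) → Set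
IsDirected {I} S = I × (∀ i j → Σ I λ k → (S i ⊑ S k) × (S j ⊑ S k))

-- The directed supremum in 𝓛 is the union.
⋃ : {I : Set} → (I → LowerReal) → Subset
⋃ {I} S q = Σ I λ i → L (S i) q

_≪_ : LowerReal → LowerReal → Set₁
x ≪ y = {I : Set} (S : I → LowerReal) → IsDirected S →
        L y ⊆ ⋃ S → Σ I λ i → x ⊑ S i

Sharp : LowerReal → Set₁
Sharp x = ∀ u v → u ≪ v → (u ≪ x) ⊎ ¬ (v ⊑ x)

Upper : LowerReal → Subset
Upper x q = ∃[ s ] (¬ L x s × s < q)

Located : LowerReal → Set
Located x = ∀ p q → p < q → L x p ⊎ Upper x q

module Submission where

-- In 𝓛 the way-below relation is explicit: u ≪ x iff u ⊑ ↓ s for some s ∈ L x,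
-- because x is the directed union of the principal ideals ↓ s, s ∈ L x.
-- Given p < q, pick p < a < b < q and apply sharpness to ↓ a ≪ ↓ b: either
-- ↓ a ≪ x, so p ∈ L x, or ↓ b ⋢ x, so b ∉ L x witnesses q ∈ U.  Conversely,
-- if u ≪ v then u ⊑ ↓ s with s < t both in L v; locatedness at s < t gives
-- either s ∈ L x, hence u ≪ x, or t ∈ U, hence t ∉ L x and v ⋢ x.

open import Defs
open import Data.Product using (Σ; ∃-syntax; _×_; _,_)
open import Data.Sum using ([_,_]′)
import Data.Sum as Sum
open import Data.Rational using (ℚ; _<_; _+_; _⊔_; 1ℚ; -_)
open import Data.Rational.Properties
  using (<-trans; ≤-<-trans; <-dense; <-respʳ-≡; <-respˡ-≡; +-monoʳ-<; +-identityʳ;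
         negative⁻¹; ⊔-sel; p≤p⊔q; p≤q⊔p)
open import Function using (_∘_)
open import Relation.Binary.PropositionalEquality using (sym)
open import Relation.Nullary using (¬_)

unbounded-below : ∀ s → ∃[ r ] r < s
unbounded-below s = s + - 1ℚ , <-respʳ-≡ (+-identityʳ s) (+-monoʳ-< s (negative⁻¹ (- 1ℚ)))

⊔-<-lub : ∀ {p q s} → p < s → q < s → p ⊔ q < s
⊔-<-lub {p} {q} p<s q<s =
  [ (λ eq → <-respˡ-≡ (sym eq) p<s) , (λ eq → <-respˡ-≡ (sym eq) q<s) ]′ (⊔-sel p q)

infix 25 ↓_

↓_ : ℚ → LowerReal
↓ s = record
  { L         = _< s
  ; lower     = <-trans
  ; inhabited = unbounded-below s
  ; directed  = λ {p} {q} p<s q<s →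
      let r , p⊔q<r , r<s = <-dense (⊔-<-lub p<s q<s)
      in r , r<s , ≤-<-trans (p≤p⊔q p q) p⊔q<r , ≤-<-trans (p≤q⊔p p q) p⊔q<r
  }

L-rounded : ∀ x {p} → L x p → ∃[ q ] (L x q × p < q)
L-rounded x xp = let q , xq , p<q , _ = directed x xp xp in q , xq , p<q

L⇒↓⊑ : ∀ x {s} → L x s → ↓ s ⊑ x
L⇒↓⊑ x xs r r<s = lower x r<s xs

Upper⇒¬L : ∀ x {q} → Upper x q → ¬ L x q
Upper⇒¬L x (s , s∉x , s<q) xq = s∉x (lower x s<q xq)

approximants : (x : LowerReal) → Σ ℚ (L x) → LowerReal
approximants x (s , _) = ↓ s

approximants-directed : ∀ x → IsDirected (approximants x)
approximants-directed x = inhabited x , λ (s , xs) (t , xt) →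
  let r , xr , s<r , t<r = directed x xs xt
  in (r , xr) , (λ q q<s → <-trans q<s s<r) , (λ q q<t → <-trans q<t t<r)

L⊆⋃approximants : ∀ x → L x ⊆ ⋃ (approximants x)
L⊆⋃approximants x p xp = let q , xq , p<q = L-rounded x xp in (q , xq) , p<q

≪⇒⊑↓ : ∀ u x → u ≪ x → ∃[ s ] (L x s × u ⊑ ↓ s)
≪⇒⊑↓ u x u≪x =
  let (s , xs) , u⊑↓s = u≪x (approximants x) (approximants-directed x) (L⊆⋃approximants x)
  in s , xs , u⊑↓s

⊑↓⇒≪ : ∀ u x {s} → L x s → u ⊑ ↓ s → u ≪ x
⊑↓⇒≪ u x xs u⊑↓s S _ x⊆⋃S =
  let i , s∈Si = x⊆⋃S _ xs in i , λ r ur → lower (S i) (u⊑↓s r ur) s∈Si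

<⇒↓≪↓ : ∀ {a b} → a < b → ↓ a ≪ ↓ b
<⇒↓≪↓ {a} {b} a<b = ⊑↓⇒≪ (↓ a) (↓ b) a<b (λ _ r<a → r<a)

Sharp⇒Located : ∀ x → Sharp x → Located x
Sharp⇒Located x sharp p q p<q =
  let a , p<a , a<q = <-dense p<q
      b , a<b , b<q = <-dense a<q
  in Sum.map (λ (↓a≪x : ↓ a ≪ x) → let s , xs , ↓a⊑↓s = ≪⇒⊑↓ (↓ a) x ↓a≪x in lower x (↓a⊑↓s p p<a) xs)
             (λ ↓b⋢x → b , ↓b⋢x ∘ L⇒↓⊑ x , b<q)
             (sharp (↓ a) (↓ b) (<⇒↓≪↓ a<b))

Located⇒Sharp : ∀ x → Located x → Sharp x
Located⇒Sharp x located u v u≪v =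
  let s , vs , u⊑↓s = ≪⇒⊑↓ u v u≪v
      t , vt , s<t  = L-rounded v vs
  in Sum.map (λ xs → ⊑↓⇒≪ u x xs u⊑↓s)
             (λ t∈U v⊑x → Upper⇒¬L x t∈U (v⊑x t vt))
             (located s t s<t)

theorem7p22 : (x : LowerReal) → (Sharp x → Located x) × (Located x → Sharp x)
theorem7p22 x = Sharp⇒Located x , Located⇒Sharp x
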